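{- Let $G$ be a finite digraph, $H\in\mathfrak{T}_a$ and $\xi\in\mathcal{H}(G,H)$. If $\mathfrak{c}_0,\dots,\mathfrak{c}_I$ is a walk in $\mathcal{G}(\xi)$ with $\iota_\xi(\mathfrak{c}_0)=\iota_\xi(\mathfrak{c}_I)$, then it is a trivial walk (i.e. $\mathfrak{c}_i=\mathfrak{c}_0$ for all $i$). In particular, $\mathcal{G}(\xi)\in\mathfrak{T}_a$.
   Context: Digraphs $G=(V(G),A(G))$: finite non-empty $V(G)$, $A(G)\subseteq V(G)\times V(G)$; loops are arcs $vv$; $G^*$ is $G$ without loops. A walk is a sequence $v_0,\dots,v_I$ ($I\ge1$) with $v_{i-1}v_i\in A(G)$ for all $i$; closed if $v_0=v_I$; trivial if all $v_i$ are equal; acyclic = no closed walk. $\mathfrak{T}_a$ = finite digraphs $G$ with $G^*$ acyclic. $\mathcal{H}(G,H)$: homomorphisms (maps with $\xi(v)\xi(w)\in A(H)$ for $vw\in A(G)$). $v,w$ adjacent if $vw$ or $wv$ is an arc. For $X\subseteq V(G)$, $v\in X$, $\gamma_X(v)$ = set of $w\in X$ equal to $v$ or joined to $v$ by a sequence in $X$ of consecutively adjacent vertices; $\Gamma_\xi(v)=\gamma_{\xi^{ -1}(\xi(v))}(v)$. For $\xi\in\mathcal{H}(G,H)$, $\mathcal{G}(\xi)$ has vertex set $\{\Gamma_\xi(v): v\in V(G)\}$ and arcs $(\mathfrak{a},\mathfrak{b})$ whenever some $a\in\mathfrak{a}$, $b\in\mathfrak{b}$ satisfy $ab\in A(G)$;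 $\iota_\xi:V(\mathcal{G}(\xi))\to V(H)$, $\Gamma_\xi(v)\mapsto\xi(v)$. -}

module Defs where

open import Data.Nat using (ℕ; zero; suc; _≤_)
open import Data.Fin using (Fin; zero; suc; inject₁; fromℕ)
open import Data.Bool using (Bool; true)
open import Data.Product using (Σ; _×_; _,_)
open import Data.Sum using (_⊎_)
open import Data.Empty using (⊥)
open import Relation.Nullary using (¬_)
open import Relation.Binary.PropositionalEquality using (_≡_)
open import Function.Bundles using (_⇔_)

-- A finite digraph with non-empty vertex set V = Fin (suc pred);
-- the arc set A(G) ⊆ V × V is given by its characteristic function.
record Digraph : Set where
  field
    pred : ℕ
    arc  : Fin (suc pred) → Fin (suc pred) → Bool

open Digraph public

V : Digraph → Set
V G = Fin (suc (pred G))

Arc : (G : Digraph) → V G → V G → Set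
Arc G v w = arc G v w ≡ true

record Walk {X : Set} (A : X → X → Set) : Set where
  field
    len   : ℕ
    len≥1 : 1 ≤ len
    vtx   : Fin (suc len) → X
    step  : ∀ (i : Fin len) → A (vtx (inject₁ i)) (vtx (suc i))

open Walk public

first : ∀ {X} {A : X → X → Set} → Walk A → X
first w = vtx w zero

last : ∀ {X} {A : X → X → Set} → Walk A → X
last w = vtx w (fromℕ (len w))

ArcStar : (G : Digraph) → V G → V G → Set
ArcStar G v w = Arc G v w × ¬ (v ≡ w)

Acyclic : (G : Digraph) → Set
Acyclic G = (w : Walk (Arc G)) → first w ≡ last w → ⊥

InTa : Digraph → Set
InTa G = (w : Walk (ArcStar G)) → first w ≡ last w → ⊥

IsHom : (G H : Digraph) → (V G → V H) → Set
IsHom G H ξ = ∀ v w → Arc G v w → Arc H (ξ v) (ξ w)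

Adj : (G : Digraph) → V G → V G → Set
Adj G v w = Arc G v w ⊎ Arc G w v

-- w ∈ γ_X(v), X given by predicate P: w = v or w is joined to v by a
-- sequence in X of consecutively adjacent vertices (k = 0 gives w = v).
InGamma : (G : Digraph) → (V G → Set) → V G → V G → Set
InGamma G P v w =
  Σ ℕ λ k → Σ (Fin (suc k) → V G) λ s →
    (s zero ≡ v) × (s (fromℕ k) ≡ w) ×
    (∀ j → P (s j)) ×
    (∀ (i : Fin k) → Adj G (s (inject₁ i)) (s (suc i)))

module _ (G H : Digraph) (ξ : V G → V H) where

  -- w ∈ Γ_ξ(v) = γ_{ξ⁻¹(ξ(v))}(v)   (v ∈ X is part of the definition of γ)
  InΓ : V G → V G → Set
  InΓ v w = InGamma G (λ x → ξ x ≡ ξ v) v w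

  -- Vertices of 𝒢(ξ) are the sets Γ_ξ(v), represented by v ∈ V(G);
  -- two representatives give the same vertex iff the sets are equal.
  SameΓ : V G → V G → Set
  SameΓ u u' = ∀ x → InΓ u x ⇔ InΓ u' x

  ArcΓ : V G → V G → Set
  ArcΓ u u' = Σ (V G) λ a → Σ (V G) λ b → InΓ u a × InΓ u' b × Arc G a b

  ιΓ : V G → V H
  ιΓ u = ξ u

  ArcΓStar : V G → V G → Set
  ArcΓStar u u' = ArcΓ u u' × ¬ SameΓ u u'

  𝒢InTa : Set
  𝒢InTa = (w : Walk ArcΓStar) → SameΓ (first w) (last w) → ⊥

-- Since ι_ξ is a homomorphism 𝒢(ξ) → H, the images of a walk c₀, …, c_I form a walk in H, and a
-- closed walk in H ∈ 𝔗_a uses loops only, so all ι_ξ(c_i) coincide.  An arc of 𝒢(ξ) between two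
-- classes with the same image joins them inside one fibre of ξ, so by connectivity the two classes
-- are the same; hence the walk is trivial.  A closed walk in 𝒢(ξ)* would be such a trivial walk,
-- contradicting the absence of loops in its first step.
module Submission where

open import Defs
open import Data.Nat using (ℕ; zero; suc; _≤_; s≤s; z≤n)
open import Data.Fin using (Fin; zero; suc; inject₁; fromℕ; fromℕ<; _≟_)
open import Data.Product using (_×_; Σ; _,_; proj₁; proj₂)
open import Data.Sum using (inj₁; inj₂)
open import Data.Unit using (⊤; tt)
open import Data.Empty using (⊥; ⊥-elim)
open import Relation.Nullary using (yes; no)
open import Relation.Binary.Definitions using (Symmetric)
open import Relation.Binary.PropositionalEquality using (_≡_; refl; sym; trans; subst; subst₂)
open import Relation.Binary.Construct.Closure.ReflexiveTransitive
  using (Star; ε; _◅_; _◅◅_; reverse; concat)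
open import Function.Bundles using (mk⇔; Equivalence)
import Function.Properties.Equivalence as ⇔

module _ {X : Set} where

  IsChain : (X → X → Set) → ∀ {n} → (Fin (suc n) → X) → Set
  IsChain R {n} f = ∀ (i : Fin n) → R (f (inject₁ i)) (f (suc i))

  -- InGamma G P is PathIn (Adj G) P.
  PathIn : (X → X → Set) → (X → Set) → X → X → Set
  PathIn R P x y = Σ ℕ λ n → Σ (Fin (suc n) → X) λ f →
    (f zero ≡ x) × (f (fromℕ n) ≡ y) × (∀ j → P (f j)) × IsChain R f

  Restrict : (X → X → Set) → (X → Set) → X → X → Set
  Restrict R P a b = P a × R a b × P b

  Restrict-sym : ∀ {R P} → Symmetric R → Symmetric (Restrict R P)
  Restrict-sym R-sym (pa , r , pb) = pb , R-sym r , pa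

  chain⇒star-from-zero : ∀ {R n} {f : Fin (suc n) → X} → IsChain R f → ∀ j → Star R (f zero) (f j)
  chain⇒star-from-zero                     st zero    = ε
  chain⇒star-from-zero {n = suc n} {f = f} st (suc j) =
    st zero ◅ chain⇒star-from-zero {f = λ k → f (suc k)} (λ i → st (suc i)) j

  chain⇒star-to-last : ∀ {R n} {f : Fin (suc n) → X} → IsChain R f → ∀ j → Star R (f j) (f (fromℕ n))
  chain⇒star-to-last {n = zero}            st zero    = ε
  chain⇒star-to-last {n = suc n} {f = f} st zero    =
    st zero ◅ chain⇒star-to-last {f = λ k → f (suc k)} (λ i → st (suc i)) zero
  chain⇒star-to-last {n = suc n} {f = f} st (suc j) =
    chain⇒star-to-last {f = λ k → f (suc k)} (λ i → st (suc i)) j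

  path⇒star : ∀ {R P x y} → PathIn R P x y → Star (Restrict R P) x y
  path⇒star {R} {P} (n , f , refl , refl , pf , st) =
    chain⇒star-from-zero {Restrict R P} {f = f} (λ i → pf (inject₁ i) , st i , pf (suc i)) (fromℕ n)

  PathIn-cons : ∀ {R P x z y} → P x → R x z → PathIn R P z y → PathIn R P x y
  PathIn-cons {R} {P} {x} px r (n , f , f0 , fl , pf , st) = suc n , f′ , refl , fl , pf′ , st′
    where
    f′ : Fin (suc (suc n)) → X
    f′ zero    = x
    f′ (suc k) = f k
    pf′ : ∀ j → P (f′ j)
    pf′ zero    = px
    pf′ (suc j) = pf j
    st′ : IsChain R f′
    st′ zero    = subst (R x) (sym f0) r
    st′ (suc i) = st i

  star⇒path : ∀ {R P x y} → (∀ {a b} → R a b → P b) → P x → Star R x y → PathIn R P x y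
  star⇒path {x = x} _   px ε        = 0 , (λ _ → x) , refl , refl , (λ _ → px) , λ ()
  star⇒path         inv px (r ◅ rs) = PathIn-cons px r (star⇒path inv (inv r) rs)

  PathIn-restrict : ∀ {R P x y} → PathIn (Restrict R P) P x y → PathIn R P x y
  PathIn-restrict (n , f , f0 , fl , pf , st) = n , f , f0 , fl , pf , λ i → proj₁ (proj₂ (st i))

  path⇒walk : ∀ {R P x y} (p : PathIn R P x y) → 1 ≤ proj₁ p →
              Σ (Walk R) λ w → (first w ≡ x) × (last w ≡ y)
  path⇒walk (n , f , f0 , fl , _ , st) n≥1 =
    record { len = n ; len≥1 = n≥1 ; vtx = f ; step = st } , f0 , fl

arc⇒loopless-star : ∀ (H : Digraph) {x y} → Arc H x y → Star (ArcStar H) x y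
arc⇒loopless-star _ {x} {y} a with x ≟ y
... | yes refl = ε
... | no  x≢y  = (a , x≢y) ◅ ε

module _ (H : Digraph) (acyclic : InTa H) where

  InTa⇒no-cycle : ∀ {x z} → ArcStar H x z → Star (ArcStar H) z x → ⊥
  InTa⇒no-cycle r rs with path⇒walk (PathIn-cons {P = λ _ → ⊤} tt r (star⇒path _ tt rs)) (s≤s z≤n)
  ... | w , w-first , w-last = acyclic w (trans w-first (sym w-last))

  InTa⇒loopless-antisym : ∀ {x y} → Star (ArcStar H) x y → Star (ArcStar H) y x → x ≡ y
  InTa⇒loopless-antisym ε        _   = refl
  InTa⇒loopless-antisym (r ◅ rs) back = ⊥-elim (InTa⇒no-cycle r (rs ◅◅ back))

  InTa⇒closed-chain-constant : ∀ {n} {f : Fin (suc n) → V H} → IsChain (Arc H) f →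
                               f zero ≡ f (fromℕ n) → ∀ j → f j ≡ f zero
  InTa⇒closed-chain-constant {f = f} st closed j =
    sym (InTa⇒loopless-antisym (concat (chain⇒star-from-zero st* j))
                               (concat (chain⇒star-to-last st* j) ◅◅ back))
    where
    st* : IsChain (Star (ArcStar H)) f
    st* i = arc⇒loopless-star H (st i)
    back : Star (ArcStar H) (f (fromℕ _)) (f zero)
    back = subst (Star (ArcStar H) (f (fromℕ _))) (sym closed) ε

module _ (G H : Digraph) (ξ : V G → V H) where

  Fibre : V H → V G → Set
  Fibre c x = ξ x ≡ c

  FibreAdj : V H → V G → V G → Set
  FibreAdj c = Restrict (Adj G) (Fibre c)

  fibreAdj-sym : ∀ {c} → Symmetric (FibreAdj c)
  fibreAdj-sym {c} = Restrict-sym {P = Fibre c} adj-sym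
    where
    adj-sym : Symmetric (Adj G)
    adj-sym (inj₁ a) = inj₂ a
    adj-sym (inj₂ a) = inj₁ a

  inΓ⇒fibre : ∀ {u x} → InΓ G H ξ u x → ξ x ≡ ξ u
  inΓ⇒fibre (k , s , _ , refl , ps , _) = ps (fromℕ k)

  inΓ⇒star : ∀ {c u x} → ξ u ≡ c → InΓ G H ξ u x → Star (FibreAdj c) u x
  inΓ⇒star refl = path⇒star

  star⇒inΓ : ∀ {c u x} → ξ u ≡ c → Star (FibreAdj c) u x → InΓ G H ξ u x
  star⇒inΓ {u = u} refl p =
    PathIn-restrict {R = Adj G} {P = Fibre (ξ u)} (star⇒path (λ (_ , _ , fb) → fb) refl p)

  star⇒sameΓ : ∀ {c u u'} → ξ u ≡ c → ξ u' ≡ c → Star (FibreAdj c) u u' → SameΓ G H ξ u u'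
  star⇒sameΓ eu eu' p x =
    mk⇔ (λ q → star⇒inΓ eu' (reverse fibreAdj-sym p ◅◅ inΓ⇒star eu q))
        (λ q → star⇒inΓ eu  (p ◅◅ inΓ⇒star eu' q))

  sameΓ⇒ι≡ : ∀ {u u'} → SameΓ G H ξ u u' → ιΓ G H ξ u ≡ ιΓ G H ξ u'
  sameΓ⇒ι≡ {u} {u'} s = sym (inΓ⇒fibre (Equivalence.from (s u') (star⇒inΓ refl ε)))

  arcΓ⇒star : ∀ {c u u'} → ξ u ≡ c → ξ u' ≡ c → ArcΓ G H ξ u u' → Star (FibreAdj c) u u'
  arcΓ⇒star eu eu' (a , b , ia , ib , ab) =
    inΓ⇒star eu ia
      ◅◅ (trans (inΓ⇒fibre ia) eu , inj₁ ab , trans (inΓ⇒fibre ib) eu')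
      ◅  reverse fibreAdj-sym (inΓ⇒star eu' ib)

  module _ (hom : IsHom G H ξ) where

    arcΓ⇒arc : ∀ {u u'} → ArcΓ G H ξ u u' → Arc H (ιΓ G H ξ u) (ιΓ G H ξ u')
    arcΓ⇒arc (a , b , ia , ib , ab) = subst₂ (Arc H) (inΓ⇒fibre ia) (inΓ⇒fibre ib) (hom a b ab)

    InTa⇒closed-walk-trivial : InTa H → (c : Walk (ArcΓ G H ξ)) →
      ιΓ G H ξ (first c) ≡ ιΓ G H ξ (last c) →
      ∀ i → SameΓ G H ξ (vtx c i) (first c)
    InTa⇒closed-walk-trivial acyclic c closed i =
      star⇒sameΓ (ι-constant i) refl (reverse fibreAdj-sym (concat (chain⇒star-from-zero fibre-chain i)))
      where
      ι-constant : ∀ j → ξ (vtx c j) ≡ ξ (first c)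
      ι-constant = InTa⇒closed-chain-constant H acyclic (λ k → arcΓ⇒arc (step c k)) closed
      fibre-chain : IsChain (Star (FibreAdj (ξ (first c)))) (vtx c)
      fibre-chain k = arcΓ⇒star (ι-constant (inject₁ k)) (ι-constant (suc k)) (step c k)

    InTa⇒𝒢InTa : InTa H → 𝒢InTa G H ξ
    InTa⇒𝒢InTa acyclic w closed =
      proj₂ (step w i) λ x → ⇔.trans (trivial (inject₁ i) x) (⇔.sym (trivial (suc i) x))
      where
      i : Fin (len w)
      i = fromℕ< (len≥1 w)
      trivial : ∀ j → SameΓ G H ξ (vtx w j) (first w)
      trivial = InTa⇒closed-walk-trivial acyclic
        (record { len = len w ; len≥1 = len≥1 w ; vtx = vtx w ; step = λ k → proj₁ (step w k) })
        (sameΓ⇒ι≡ closed)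

lemma5 : (G H : Digraph) → InTa H → (ξ : V G → V H) → IsHom G H ξ →
    ((c : Walk (ArcΓ G H ξ)) →
      ιΓ G H ξ (first c) ≡ ιΓ G H ξ (last c) →
      ∀ (i : Fin (suc (len c))) → SameΓ G H ξ (vtx c i) (first c))
    × 𝒢InTa G H ξ
lemma5 G H acyclic ξ hom = InTa⇒closed-walk-trivial G H ξ hom acyclic , InTa⇒𝒢InTa G H ξ hom acyclic
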